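{- Define polynomials $p_n(x,y,z)$ by \[ \sum_{n=0}^\infty p_n(x,y,z)q^n=\prod_{j=0}^\infty\left(1+xq^{2^j}\right)\left(1+yq^{2^j}+zq^{2\cdot 2^j}\right), \] and for $n\ge 0$ set $Q_n=p_{2^{n+1}-2}(x,y,z)$ and $R_n=p_{2^n-1}(x,y,z)$. Then $Q_0=1$, $Q_1=xy+x+y+z$, $R_0=1$, $R_1=x+y$, and for all $n\ge 1$, \begin{align*} Q_{n+1}&=(xy+x+y+z)Q_n-(x^2y+xy^2+yz)Q_{n-1},\\ R_{n+1}&=(xy+x+y+z)R_n-(x^2y+xy^2+yz)R_{n-1}. \end{align*} -}

module Defs where

open import Level using (Level)
open import Data.Nat using (ℕ; zero; suc; _^_; _∸_) renaming (_*_ to _*ℕ_)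
open import Data.List using (List; []; _∷_; replicate; _++_; upTo; foldr; map)
open import Algebra.Bundles using (CommutativeRing)

-- Power series in q are represented by (finite) coefficient lists [a₀, a₁, …]
-- over a commutative ring R.  The polynomials p_n(x,y,z) are evaluated at
-- arbitrary ring elements x y z; an integer polynomial identity holds iff it
-- holds in every commutative ring for all x y z (take R = ℤ[x,y,z]).
module Poly {c ℓ : Level} (R : CommutativeRing c ℓ) where
  open CommutativeRing R

  Ser : Set c
  Ser = List Carrier

  _⊕_ : Ser → Ser → Ser
  []       ⊕ bs       = bs
  (a ∷ as) ⊕ []       = a ∷ as
  (a ∷ as) ⊕ (b ∷ bs) = (a + b) ∷ (as ⊕ bs)

  scale : Carrier → Ser → Ser
  scale a = map (a *_)

  _⊗_ : Ser → Ser → Ser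
  []       ⊗ bs = []
  (a ∷ as) ⊗ bs = scale a bs ⊕ (0# ∷ (as ⊗ bs))

  mono : Carrier → ℕ → Ser
  mono a k = replicate k 0# ++ (a ∷ [])

  coeff : Ser → ℕ → Carrier
  coeff []       _       = 0#
  coeff (a ∷ as) zero    = a
  coeff (a ∷ as) (suc n) = coeff as n

  module _ (x y z : Carrier) where

    factor : ℕ → Ser
    factor j = (mono 1# 0 ⊕ mono x (2 ^ j))
             ⊗ (mono 1# 0 ⊕ (mono y (2 ^ j) ⊕ mono z (2 *ℕ 2 ^ j)))

    partialProd : ℕ → Ser
    partialProd m = foldr (λ j acc → factor j ⊗ acc) (mono 1# 0) (upTo m)

    -- p_n(x,y,z): coefficient of q^n in the infinite product.  Factors with
    -- j ≥ n+1 have 2^j > n and so are ≡ 1 mod q^{n+1}; hence the coefficient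
    -- of q^n is that of the finite product over j = 0, …, n.
    p : ℕ → Carrier
    p n = coeff (partialProd (suc n)) n

    Q : ℕ → Carrier
    Q n = p (2 ^ (suc n) ∸ 2)

    R′ : ℕ → Carrier
    R′ n = p (2 ^ n ∸ 1)

-- Write P M for the product of the first M factors.  Since factor (j + 1) is
-- factor j with q replaced by q², P (M + 1) = F₀ · P M (q²), where
-- F₀ = (1 + x q)(1 + y q + z q²) = (1 + (xy + z) q²) + q ((x + y) + xz q²).
-- Hence P (M + 1) and P M agree below degree 2^M, so coefficients of P M of
-- degree < 2^M are already the p n, and comparing coefficients of q^(2m) and
-- q^(2m+1) gives
--   p (2m) = p m + (xy + z) p (m - 1),   p (2m + 1) = (x + y) p m + xz p (m - 1).
-- Along the indices 2ⁿ - 1 these say that (R′ n, Q (n - 1)) evolves by the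
-- transfer matrix [[x + y, xz], [1, xy + z]]; by Cayley–Hamilton both
-- components satisfy the linear recurrence given by its trace and determinant.
module Submission where

open import Defs
open import Level using (Level)
open import Data.Nat using (ℕ; zero; suc; _≤_; _<_; _∸_; _^_; z≤n; s≤s)
  renaming (_+_ to _+ℕ_; _*_ to _*ℕ_)
open import Data.Nat.Properties
  using ( n<1+n; <⇒≤; <-trans; ≤-trans; ≤-reflexive; m≤m+n; m≤n+m; +-mono-≤
        ; *-suc; *-monoʳ-≤; *-monoʳ-<; *-cancelˡ-<; m^n>0; ^-monoʳ-≤)
  renaming (+-comm to +ℕ-comm)
open import Data.List using ([]; _∷_; applyUpTo; foldr)
open import Data.Product using (_×_; _,_)
open import Function using (_∘_; id)
open import Algebra.Bundles using (CommutativeRing)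
open import Relation.Binary.Structures using (IsEquivalence)
open import Relation.Binary.PropositionalEquality as ≡ using (_≡_)
import Relation.Binary.Reasoning.Setoid as SetoidReasoning
import Algebra.Properties.Group as GroupProperties
import Algebra.Solver.Ring.NaturalCoefficients.Default as NaturalSolver

data EvenOdd : ℕ → Set where
  even : ∀ m → EvenOdd (2 *ℕ m)
  odd  : ∀ m → EvenOdd (suc (2 *ℕ m))

evenOdd : ∀ n → EvenOdd n
evenOdd zero = even zero
evenOdd (suc n) with evenOdd n
... | even m = odd m
... | odd m = ≡.subst EvenOdd (*-suc 2 m) (even (suc m))

n<2^n : ∀ n → n < 2 ^ n
n<2^n zero = s≤s z≤n
n<2^n (suc n) = +-mono-≤ (m^n>0 2 n) (≤-trans (n<2^n n) (m≤m+n _ 0))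

2^[1+k]≡2+2*[2^k∸1] : ∀ k → 2 ^ suc k ≡ 2 +ℕ 2 *ℕ (2 ^ k ∸ 1)
2^[1+k]≡2+2*[2^k∸1] k with 2 ^ k | m^n>0 2 k
... | suc j | _ = *-suc 2 j

1+2m<2n : ∀ {m n} → m < n → suc (2 *ℕ m) < 2 *ℕ n
1+2m<2n {m} m<n = ≤-trans (≤-reflexive (≡.sym (*-suc 2 m))) (*-monoʳ-≤ 2 m<n)

module Transfer {c ℓ : Level} (Rng : CommutativeRing c ℓ) where
  open CommutativeRing Rng
  open NaturalSolver commutativeSemiring using (solve; _:=_; _:+_; _:*_)
  open SetoidReasoning setoid

  +≈⇒≈- : ∀ {u v w} → u + w ≈ v → u ≈ v - w
  +≈⇒≈- {u} {v} {w} u+w≈v = begin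
    u           ≈⟨ GroupProperties.//-rightDividesʳ +-group w u ⟨
    (u + w) - w ≈⟨ +-congʳ u+w≈v ⟩
    v - w       ∎

  -- (r, s) evolves by the matrix [[a, b], [c′, e]] of trace t and determinant d;
  -- by Cayley–Hamilton each coordinate satisfies u (k + 2) = t u (k + 1) - d u k.
  first-coordinate-recurrence : ∀ {a b c′ e t d} (r s : ℕ → Carrier) →
    (∀ k → r (suc k) ≈ a * r k + b * s k) → (∀ k → s (suc k) ≈ c′ * r k + e * s k) →
    t ≈ a + e → d + b * c′ ≈ a * e →
    ∀ k → r (2 +ℕ k) ≈ t * r (1 +ℕ k) - d * r k
  first-coordinate-recurrence {a} {b} {c′} {e} {t} {d} r s r-step s-step trace det k = +≈⇒≈- (begin
    r (2 +ℕ k) + d * r k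
      ≈⟨ +-congʳ (trans (r-step (suc k)) (+-congˡ (*-congˡ (s-step k)))) ⟩
    (a * r (1 +ℕ k) + b * (c′ * r k + e * s k)) + d * r k
      ≈⟨ solve 8 (λ a b c′ e d r₁ r₀ s₀ →
              (a :* r₁ :+ b :* (c′ :* r₀ :+ e :* s₀)) :+ d :* r₀
            := a :* r₁ :+ e :* (b :* s₀) :+ (d :+ b :* c′) :* r₀)
          refl a b c′ e d (r (1 +ℕ k)) (r k) (s k) ⟩
    a * r (1 +ℕ k) + e * (b * s k) + (d + b * c′) * r k
      ≈⟨ +-congˡ (*-congʳ det) ⟩
    a * r (1 +ℕ k) + e * (b * s k) + (a * e) * r k
      ≈⟨ solve 6 (λ a b e r₁ r₀ s₀ →
              a :* r₁ :+ e :* (b :* s₀) :+ (a :* e) :* r₀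
            := a :* r₁ :+ e :* (a :* r₀ :+ b :* s₀))
          refl a b e (r (1 +ℕ k)) (r k) (s k) ⟩
    a * r (1 +ℕ k) + e * (a * r k + b * s k)
      ≈⟨ +-congˡ (*-congˡ (r-step k)) ⟨
    a * r (1 +ℕ k) + e * r (1 +ℕ k)
      ≈⟨ distribʳ (r (1 +ℕ k)) a e ⟨
    (a + e) * r (1 +ℕ k)
      ≈⟨ *-congʳ trace ⟨
    t * r (1 +ℕ k) ∎)

  second-coordinate-recurrence : ∀ {a b c′ e t d} (r s : ℕ → Carrier) →
    (∀ k → r (suc k) ≈ a * r k + b * s k) → (∀ k → s (suc k) ≈ c′ * r k + e * s k) →
    t ≈ a + e → d + b * c′ ≈ a * e →
    ∀ k → s (2 +ℕ k) ≈ t * s (1 +ℕ k) - d * s k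
  second-coordinate-recurrence {a} {b} {c′} {e} r s r-step s-step trace det =
    first-coordinate-recurrence s r
      (λ k → trans (s-step k) (+-comm (c′ * r k) (e * s k)))
      (λ k → trans (r-step k) (+-comm (a * r k) (b * s k)))
      (trans trace (+-comm a e))
      (trans (+-congˡ (*-comm c′ b)) (trans det (*-comm a e)))

module PowerSeries {c ℓ : Level} (Rng : CommutativeRing c ℓ) where
  open CommutativeRing Rng hiding (zero)
  open Poly Rng
  open NaturalSolver commutativeSemiring using (solve; _:=_; _:+_; _:*_; con)
  open SetoidReasoning setoid

  infix 4 _≋_ _≈[<_]_

  record _≋_ (s t : Ser) : Set ℓ where
    constructor coeffwise
    field coeff-≈ : ∀ n → coeff s n ≈ coeff t n
  open _≋_

  _≈[<_]_ : Ser → ℕ → Ser → Set ℓ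
  s ≈[< N ] t = ∀ {n} → n < N → coeff s n ≈ coeff t n

  ≋-isEquivalence : IsEquivalence _≋_
  ≋-isEquivalence = record
    { refl  = coeffwise λ _ → refl
    ; sym   = λ e → coeffwise λ n → sym (coeff-≈ e n)
    ; trans = λ e f → coeffwise λ n → trans (coeff-≈ e n) (coeff-≈ f n)
    }

  open IsEquivalence ≋-isEquivalence
    using () renaming (refl to ≋-refl; sym to ≋-sym; trans to ≋-trans; reflexive to ≡⇒≋)

  ∷-cong : ∀ {u v s t} → u ≈ v → s ≋ t → u ∷ s ≋ v ∷ t
  ∷-cong u≈v s≋t = coeffwise λ { zero → u≈v ; (suc n) → coeff-≈ s≋t n }

  []≋0 : [] ≋ 0# ∷ []
  []≋0 = coeffwise λ { zero → refl ; (suc n) → refl }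

  coeff-⊕ : ∀ s t n → coeff (s ⊕ t) n ≈ coeff s n + coeff t n
  coeff-⊕ []       t        n       = sym (+-identityˡ _)
  coeff-⊕ (a ∷ as) []       n       = sym (+-identityʳ _)
  coeff-⊕ (a ∷ as) (b ∷ bs) zero    = refl
  coeff-⊕ (a ∷ as) (b ∷ bs) (suc n) = coeff-⊕ as bs n

  coeff-scale : ∀ u s n → coeff (scale u s) n ≈ u * coeff s n
  coeff-scale u []       n       = sym (zeroʳ u)
  coeff-scale u (a ∷ as) zero    = refl
  coeff-scale u (a ∷ as) (suc n) = coeff-scale u as n

  coeff-∷⊗ : ∀ u as t n → coeff ((u ∷ as) ⊗ t) n ≈ u * coeff t n + coeff (0# ∷ (as ⊗ t)) n
  coeff-∷⊗ u as t n =
    trans (coeff-⊕ (scale u t) (0# ∷ (as ⊗ t)) n) (+-congʳ (coeff-scale u t n))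

  coeff-0∷-⊕ : ∀ s t n → coeff (0# ∷ (s ⊕ t)) n ≈ coeff (0# ∷ s) n + coeff (0# ∷ t) n
  coeff-0∷-⊕ s t zero    = sym (+-identityˡ 0#)
  coeff-0∷-⊕ s t (suc n) = coeff-⊕ s t n

  ⊕-cong : ∀ {s s′ t t′} → s ≋ s′ → t ≋ t′ → s ⊕ t ≋ s′ ⊕ t′
  ⊕-cong {s} {s′} {t} {t′} s≋s′ t≋t′ = coeffwise λ n → begin
    coeff (s ⊕ t) n             ≈⟨ coeff-⊕ s t n ⟩
    coeff s n + coeff t n       ≈⟨ +-cong (coeff-≈ s≋s′ n) (coeff-≈ t≋t′ n) ⟩
    coeff s′ n + coeff t′ n     ≈⟨ coeff-⊕ s′ t′ n ⟨
    coeff (s′ ⊕ t′) n           ∎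

  scale-cong : ∀ {u v s t} → u ≈ v → s ≋ t → scale u s ≋ scale v t
  scale-cong {u} {v} {s} {t} u≈v s≋t = coeffwise λ n → begin
    coeff (scale u s) n ≈⟨ coeff-scale u s n ⟩
    u * coeff s n       ≈⟨ *-cong u≈v (coeff-≈ s≋t n) ⟩
    v * coeff t n       ≈⟨ coeff-scale v t n ⟨
    coeff (scale v t) n ∎

  ⊗-congʳ-< : ∀ a {s t N} → s ≈[< N ] t → a ⊗ s ≈[< N ] a ⊗ t
  ⊗-congʳ-< []       s≈t n<N = refl
  ⊗-congʳ-< (u ∷ as) {s} {t} {N} s≈t {n} n<N = begin
    coeff ((u ∷ as) ⊗ s) n                   ≈⟨ coeff-∷⊗ u as s n ⟩
    u * coeff s n + coeff (0# ∷ (as ⊗ s)) n  ≈⟨ +-cong (*-congˡ (s≈t n<N)) (tail n n<N) ⟩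
    u * coeff t n + coeff (0# ∷ (as ⊗ t)) n  ≈⟨ coeff-∷⊗ u as t n ⟨
    coeff ((u ∷ as) ⊗ t) n                   ∎
    where
    tail : ∀ n → n < N → coeff (0# ∷ (as ⊗ s)) n ≈ coeff (0# ∷ (as ⊗ t)) n
    tail zero    _       = refl
    tail (suc k) 1+k<N = ⊗-congʳ-< as s≈t (<⇒≤ 1+k<N)

  ⊗-congʳ : ∀ a {s t} → s ≋ t → a ⊗ s ≋ a ⊗ t
  ⊗-congʳ a {s} {t} s≋t =
    coeffwise λ n → ⊗-congʳ-< a {s} {t} {suc n} (λ {k} _ → coeff-≈ s≋t k) (n<1+n n)

  ⊗-zeroˡ : ∀ a t → a ≋ [] → a ⊗ t ≋ []
  ⊗-zeroˡ []       t a≋0 = ≋-refl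
  ⊗-zeroˡ (u ∷ as) t a≋0 = coeffwise λ n → begin
    coeff ((u ∷ as) ⊗ t) n
      ≈⟨ coeff-∷⊗ u as t n ⟩
    u * coeff t n + coeff (0# ∷ (as ⊗ t)) n
      ≈⟨ +-cong (*-congʳ (coeff-≈ a≋0 zero)) (coeff-≈ tail≋0 n) ⟩
    0# * coeff t n + 0#
      ≈⟨ +-identityʳ _ ⟩
    0# * coeff t n
      ≈⟨ zeroˡ _ ⟩
    0# ∎
    where
    tail≋0 : 0# ∷ (as ⊗ t) ≋ []
    tail≋0 = ≋-trans (∷-cong refl (⊗-zeroˡ as t (coeffwise (coeff-≈ a≋0 ∘ suc))))
                     (≋-sym []≋0)

  ⊗-congˡ : ∀ {a b} t → a ≋ b → a ⊗ t ≋ b ⊗ t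
  ⊗-congˡ {[]}     {[]}     t a≋b = ≋-refl
  ⊗-congˡ {[]}     {v ∷ bs} t a≋b = ≋-sym (⊗-zeroˡ (v ∷ bs) t (≋-sym a≋b))
  ⊗-congˡ {u ∷ as} {[]}     t a≋b = ⊗-zeroˡ (u ∷ as) t a≋b
  ⊗-congˡ {u ∷ as} {v ∷ bs} t a≋b =
    ⊕-cong (scale-cong (coeff-≈ a≋b zero) ≋-refl)
           (∷-cong refl (⊗-congˡ {as} {bs} t (coeffwise (coeff-≈ a≋b ∘ suc))))

  ⊗-cong : ∀ {a b s t} → a ≋ b → s ≋ t → a ⊗ s ≋ b ⊗ t
  ⊗-cong {b = b} {s} a≋b s≋t = ≋-trans (⊗-congˡ s a≋b) (⊗-congʳ b s≋t)

  ⊗-distribʳ-⊕ : ∀ a b t → (a ⊕ b) ⊗ t ≋ (a ⊗ t) ⊕ (b ⊗ t)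
  ⊗-distribʳ-⊕ []       b        t = ≋-refl
  ⊗-distribʳ-⊕ (u ∷ as) []       t = coeffwise λ n →
    sym (trans (coeff-⊕ ((u ∷ as) ⊗ t) [] n) (+-identityʳ _))
  ⊗-distribʳ-⊕ (u ∷ as) (v ∷ bs) t = coeffwise λ n → begin
    coeff (((u + v) ∷ (as ⊕ bs)) ⊗ t) n
      ≈⟨ coeff-∷⊗ (u + v) (as ⊕ bs) t n ⟩
    (u + v) * coeff t n + coeff (0# ∷ ((as ⊕ bs) ⊗ t)) n
      ≈⟨ +-congˡ (trans (coeff-≈ (∷-cong refl (⊗-distribʳ-⊕ as bs t)) n)
                        (coeff-0∷-⊕ (as ⊗ t) (bs ⊗ t) n)) ⟩
    (u + v) * coeff t n + (coeff (0# ∷ (as ⊗ t)) n + coeff (0# ∷ (bs ⊗ t)) n)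
      ≈⟨ solve 5 (λ u v w p q → (u :+ v) :* w :+ (p :+ q) := (u :* w :+ p) :+ (v :* w :+ q))
           refl u v (coeff t n) (coeff (0# ∷ (as ⊗ t)) n) (coeff (0# ∷ (bs ⊗ t)) n) ⟩
    (u * coeff t n + coeff (0# ∷ (as ⊗ t)) n) + (v * coeff t n + coeff (0# ∷ (bs ⊗ t)) n)
      ≈⟨ +-cong (coeff-∷⊗ u as t n) (coeff-∷⊗ v bs t n) ⟨
    coeff ((u ∷ as) ⊗ t) n + coeff ((v ∷ bs) ⊗ t) n
      ≈⟨ coeff-⊕ ((u ∷ as) ⊗ t) ((v ∷ bs) ⊗ t) n ⟨
    coeff (((u ∷ as) ⊗ t) ⊕ ((v ∷ bs) ⊗ t)) n ∎

  0∷-⊗ : ∀ a t → (0# ∷ a) ⊗ t ≋ 0# ∷ (a ⊗ t)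
  0∷-⊗ a t =
    coeffwise λ n → trans (coeff-∷⊗ 0# a t n) (trans (+-congʳ (zeroˡ _)) (+-identityˡ _))

  coeff-binomial⊗ : ∀ u v t n →
    coeff ((u ∷ v ∷ []) ⊗ t) n ≈ u * coeff t n + v * coeff (0# ∷ t) n
  coeff-binomial⊗ u v t n = trans (coeff-∷⊗ u (v ∷ []) t n) (+-congˡ (coeff-v⊗ n))
    where
    coeff-v⊗ : ∀ n → coeff (0# ∷ ((v ∷ []) ⊗ t)) n ≈ v * coeff (0# ∷ t) n
    coeff-v⊗ zero    = sym (zeroʳ v)
    coeff-v⊗ (suc k) =
      trans (coeff-∷⊗ v [] t k) (trans (+-congˡ (sym (coeff-≈ []≋0 k))) (+-identityʳ _))

  dilate : Ser → Ser
  dilate []       = []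
  dilate (a ∷ as) = a ∷ 0# ∷ dilate as

  coeff-dilate-even : ∀ s m → coeff (dilate s) (2 *ℕ m) ≡ coeff s m
  coeff-dilate-even []       m       = ≡.refl
  coeff-dilate-even (a ∷ as) zero    = ≡.refl
  coeff-dilate-even (a ∷ as) (suc m) =
    ≡.trans (≡.cong (coeff (dilate (a ∷ as))) (*-suc 2 m)) (coeff-dilate-even as m)

  coeff-dilate-odd : ∀ s m → coeff (dilate s) (suc (2 *ℕ m)) ≡ 0#
  coeff-dilate-odd []       m       = ≡.refl
  coeff-dilate-odd (a ∷ as) zero    = ≡.refl
  coeff-dilate-odd (a ∷ as) (suc m) =
    ≡.trans (≡.cong (coeff (dilate (a ∷ as)) ∘ suc) (*-suc 2 m)) (coeff-dilate-odd as m)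

  dilate-cong-< : ∀ {s t N} → s ≈[< N ] t → dilate s ≈[< 2 *ℕ N ] dilate t
  dilate-cong-< {s} {t} {N} s≈t {n} n<2N with evenOdd n
  ... | even m = begin
    coeff (dilate s) (2 *ℕ m) ≡⟨ coeff-dilate-even s m ⟩
    coeff s m                 ≈⟨ s≈t (*-cancelˡ-< 2 m N n<2N) ⟩
    coeff t m                 ≡⟨ coeff-dilate-even t m ⟨
    coeff (dilate t) (2 *ℕ m) ∎
  ... | odd m = reflexive (≡.trans (coeff-dilate-odd s m) (≡.sym (coeff-dilate-odd t m)))

  dilate-cong : ∀ {s t} → s ≋ t → dilate s ≋ dilate t
  dilate-cong {s} {t} s≋t =
    coeffwise λ n → dilate-cong-< {s} {t} {suc n} (λ {k} _ → coeff-≈ s≋t k) (m≤m+n (suc n) _)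

  dilate-⊕ : ∀ s t → dilate (s ⊕ t) ≋ dilate s ⊕ dilate t
  dilate-⊕ []       t        = ≋-refl
  dilate-⊕ (a ∷ as) []       = ≋-refl
  dilate-⊕ (a ∷ as) (b ∷ bs) = ∷-cong refl (∷-cong (sym (+-identityˡ 0#)) (dilate-⊕ as bs))

  dilate-scale : ∀ u s → dilate (scale u s) ≋ scale u (dilate s)
  dilate-scale u []       = ≋-refl
  dilate-scale u (a ∷ as) = ∷-cong refl (∷-cong (sym (zeroʳ u)) (dilate-scale u as))

  dilate-⊗ : ∀ s t → dilate (s ⊗ t) ≋ dilate s ⊗ dilate t
  dilate-⊗ []       t = ≋-refl
  dilate-⊗ (a ∷ as) t =
    ≋-trans (dilate-⊕ (scale a t) (0# ∷ (as ⊗ t)))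
            (⊕-cong (dilate-scale a t)
                    (∷-cong refl (≋-trans (∷-cong refl (dilate-⊗ as t))
                                          (≋-sym (0∷-⊗ (dilate as) (dilate t))))))

  dilate-mono : ∀ a k → dilate (mono a k) ≋ mono a (2 *ℕ k)
  dilate-mono a zero = ∷-cong refl (≋-sym []≋0)
  dilate-mono a (suc k) =
    ≡.subst (λ j → dilate (mono a (suc k)) ≋ mono a j) (≡.sym (*-suc 2 k))
            (∷-cong refl (∷-cong refl (dilate-mono a k)))

  interleave : Ser → Ser → Ser
  interleave a b = dilate a ⊕ (0# ∷ dilate b)

  coeff-interleave-even : ∀ a b m → coeff (interleave a b) (2 *ℕ m) ≈ coeff a m
  coeff-interleave-even a b m = begin
    coeff (interleave a b) (2 *ℕ m)
      ≈⟨ coeff-⊕ (dilate a) (0# ∷ dilate b) (2 *ℕ m) ⟩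
    coeff (dilate a) (2 *ℕ m) + coeff (0# ∷ dilate b) (2 *ℕ m)
      ≈⟨ +-cong (reflexive (coeff-dilate-even a m)) (shifted-odd m) ⟩
    coeff a m + 0#
      ≈⟨ +-identityʳ _ ⟩
    coeff a m ∎
    where
    shifted-odd : ∀ m → coeff (0# ∷ dilate b) (2 *ℕ m) ≈ 0#
    shifted-odd zero    = refl
    shifted-odd (suc m) =
      reflexive (≡.trans (≡.cong (coeff (0# ∷ dilate b)) (*-suc 2 m)) (coeff-dilate-odd b m))

  coeff-interleave-odd : ∀ a b m → coeff (interleave a b) (suc (2 *ℕ m)) ≈ coeff b m
  coeff-interleave-odd a b m = begin
    coeff (interleave a b) (suc (2 *ℕ m))
      ≈⟨ coeff-⊕ (dilate a) (0# ∷ dilate b) (suc (2 *ℕ m)) ⟩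
    coeff (dilate a) (suc (2 *ℕ m)) + coeff (dilate b) (2 *ℕ m)
      ≈⟨ +-cong (reflexive (coeff-dilate-odd a m)) (reflexive (coeff-dilate-even b m)) ⟩
    0# + coeff b m
      ≈⟨ +-identityˡ _ ⟩
    coeff b m ∎

  interleave-⊗-dilate : ∀ a b s → interleave a b ⊗ dilate s ≋ interleave (a ⊗ s) (b ⊗ s)
  interleave-⊗-dilate a b s =
    ≋-trans (⊗-distribʳ-⊕ (dilate a) (0# ∷ dilate b) (dilate s))
            (⊕-cong (≋-sym (dilate-⊗ a s))
                    (≋-trans (0∷-⊗ (dilate b) (dilate s)) (∷-cong refl (≋-sym (dilate-⊗ b s)))))

  dilate-mono-⊕ : ∀ a k s → dilate (mono a k ⊕ s) ≋ mono a (2 *ℕ k) ⊕ dilate s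
  dilate-mono-⊕ a k s = ≋-trans (dilate-⊕ (mono a k) s) (⊕-cong (dilate-mono a k) ≋-refl)

  ∏ : (ℕ → Ser) → ℕ → Ser
  ∏ A zero    = mono 1# 0
  ∏ A (suc m) = A 0 ⊗ ∏ (A ∘ suc) m

  foldr-applyUpTo≡∏ : ∀ (A : ℕ → Ser) (f : ℕ → ℕ) m →
    foldr (λ j acc → A j ⊗ acc) (mono 1# 0) (applyUpTo f m) ≡ ∏ (A ∘ f) m
  foldr-applyUpTo≡∏ A f zero    = ≡.refl
  foldr-applyUpTo≡∏ A f (suc m) = ≡.cong (A (f 0) ⊗_) (foldr-applyUpTo≡∏ A (f ∘ suc) m)

  ∏-dilate : ∀ {A B} m → (∀ i → A i ≋ dilate (B i)) → ∏ A m ≋ dilate (∏ B m)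
  ∏-dilate zero    A≋B = ∷-cong refl []≋0
  ∏-dilate {A} {B} (suc m) A≋B =
    ≋-trans (⊗-cong (A≋B 0) (∏-dilate m (A≋B ∘ suc)))
            (≋-sym (dilate-⊗ (B 0) (∏ (B ∘ suc) m)))

  module ProductCoefficients (x y z : Carrier) where

    F P : ℕ → Ser
    F = factor x y z
    P = partialProd x y z

    factor-suc : ∀ j → F (suc j) ≋ dilate (F j)
    factor-suc j = ≋-sym (≋-trans (dilate-⊗ first second) (⊗-cong first≋ second≋))
      where
      first second : Ser
      first  = mono 1# 0 ⊕ mono x (2 ^ j)
      second = mono 1# 0 ⊕ (mono y (2 ^ j) ⊕ mono z (2 *ℕ 2 ^ j))
      first≋ : dilate first ≋ mono 1# 0 ⊕ mono x (2 ^ suc j)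
      first≋ = ≋-trans (dilate-mono-⊕ 1# 0 (mono x (2 ^ j)))
                       (⊕-cong (≋-refl {mono 1# 0}) (dilate-mono x (2 ^ j)))
      second≋ : dilate second ≋ mono 1# 0 ⊕ (mono y (2 ^ suc j) ⊕ mono z (2 *ℕ 2 ^ suc j))
      second≋ = ≋-trans (dilate-mono-⊕ 1# 0 (mono y (2 ^ j) ⊕ mono z (2 *ℕ 2 ^ j)))
        (⊕-cong (≋-refl {mono 1# 0})
          (≋-trans (dilate-mono-⊕ y (2 ^ j) (mono z (2 *ℕ 2 ^ j)))
                   (⊕-cong (≋-refl {mono y (2 ^ suc j)}) (dilate-mono z (2 *ℕ 2 ^ j)))))

    partialProd-suc : ∀ m → P (suc m) ≋ F 0 ⊗ dilate (P m)
    partialProd-suc m = ⊗-congʳ (F 0)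
      (≋-trans (≡⇒≋ (foldr-applyUpTo≡∏ F suc m))
      (≋-trans (∏-dilate m factor-suc)
               (dilate-cong (≡⇒≋ (≡.sym (foldr-applyUpTo≡∏ F id m))))))

    evenPart oddPart : Ser
    evenPart = 1# ∷ x * y + z ∷ []
    oddPart  = x + y ∷ x * z ∷ []

    factor-zero : F 0 ≋ interleave evenPart oddPart
    factor-zero = coeffwise λ where
      0 → solve 3 (λ x y z → (con 1 :+ con 0) :* (con 1 :+ (con 0 :+ con 0)) :+ con 0
                           := con 1 :+ con 0) refl x y z
      1 → solve 3 (λ x y z → (con 1 :+ con 0) :* (y :+ con 0) :+ (x :* (con 1 :+ (con 0 :+ con 0)) :+ con 0)
                           := con 0 :+ (x :+ y)) refl x y z
      2 → solve 3 (λ x y z → (con 1 :+ con 0) :* z :+ x :* (y :+ con 0)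
                           := (x :* y :+ z) :+ con 0) refl x y z
      3 → sym (+-identityˡ (x * z))
      4 → refl
      (suc (suc (suc (suc (suc n))))) → refl

    partialProd-suc-interleave : ∀ M → P (suc M) ≋ interleave (evenPart ⊗ P M) (oddPart ⊗ P M)
    partialProd-suc-interleave M =
      ≋-trans (partialProd-suc M)
              (≋-trans (⊗-congˡ (dilate (P M)) factor-zero)
                       (interleave-⊗-dilate evenPart oddPart (P M)))

    coeff-partialProd-even : ∀ M m →
      coeff (P (suc M)) (2 *ℕ m) ≈ coeff (P M) m + (x * y + z) * coeff (0# ∷ P M) m
    coeff-partialProd-even M m = begin
      coeff (P (suc M)) (2 *ℕ m)
        ≈⟨ coeff-≈ (partialProd-suc-interleave M) (2 *ℕ m) ⟩
      coeff (interleave (evenPart ⊗ P M) (oddPart ⊗ P M)) (2 *ℕ m)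
        ≈⟨ coeff-interleave-even (evenPart ⊗ P M) (oddPart ⊗ P M) m ⟩
      coeff (evenPart ⊗ P M) m
        ≈⟨ coeff-binomial⊗ 1# (x * y + z) (P M) m ⟩
      1# * coeff (P M) m + (x * y + z) * coeff (0# ∷ P M) m
        ≈⟨ +-congʳ (*-identityˡ _) ⟩
      coeff (P M) m + (x * y + z) * coeff (0# ∷ P M) m ∎

    coeff-partialProd-odd : ∀ M m →
      coeff (P (suc M)) (suc (2 *ℕ m)) ≈ (x + y) * coeff (P M) m + (x * z) * coeff (0# ∷ P M) m
    coeff-partialProd-odd M m = begin
      coeff (P (suc M)) (suc (2 *ℕ m))
        ≈⟨ coeff-≈ (partialProd-suc-interleave M) (suc (2 *ℕ m)) ⟩
      coeff (interleave (evenPart ⊗ P M) (oddPart ⊗ P M)) (suc (2 *ℕ m))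
        ≈⟨ coeff-interleave-odd (evenPart ⊗ P M) (oddPart ⊗ P M) m ⟩
      coeff (oddPart ⊗ P M) m
        ≈⟨ coeff-binomial⊗ (x + y) (x * z) (P M) m ⟩
      (x + y) * coeff (P M) m + (x * z) * coeff (0# ∷ P M) m ∎

    partialProd-stable : ∀ M → P (suc M) ≈[< 2 ^ M ] P M
    partialProd-stable zero {zero} _ = begin
      coeff (P 1) 0                     ≈⟨ coeff-partialProd-even 0 0 ⟩
      coeff (P 0) 0 + (x * y + z) * 0#  ≈⟨ +-congˡ (zeroʳ _) ⟩
      coeff (P 0) 0 + 0#                ≈⟨ +-identityʳ _ ⟩
      coeff (P 0) 0                     ∎
    partialProd-stable zero {suc n} (s≤s ())
    partialProd-stable (suc M) {n} n<2^[1+M] = begin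
      coeff (P (2 +ℕ M)) n
        ≈⟨ coeff-≈ (partialProd-suc (suc M)) n ⟩
      coeff (F 0 ⊗ dilate (P (suc M))) n
        ≈⟨ ⊗-congʳ-< (F 0) {dilate (P (suc M))} {dilate (P M)}
             (dilate-cong-< {P (suc M)} {P M} (partialProd-stable M)) n<2^[1+M] ⟩
      coeff (F 0 ⊗ dilate (P M)) n
        ≈⟨ coeff-≈ (partialProd-suc M) n ⟨
      coeff (P (suc M)) n ∎

    partialProd-stable-+ : ∀ d M → P (d +ℕ M) ≈[< 2 ^ M ] P M
    partialProd-stable-+ zero    M n<2^M = refl
    partialProd-stable-+ (suc d) M n<2^M =
      trans (partialProd-stable (d +ℕ M) (≤-trans n<2^M (^-monoʳ-≤ 2 (m≤n+m M d))))
            (partialProd-stable-+ d M n<2^M)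

    coeff-partialProd : ∀ M {n} → n < 2 ^ M → coeff (P M) n ≈ p x y z n
    coeff-partialProd M {n} n<2^M = begin
      coeff (P M) n             ≈⟨ partialProd-stable-+ (suc n) M n<2^M ⟨
      coeff (P (suc n +ℕ M)) n  ≡⟨ ≡.cong (λ K → coeff (P K) n) (+ℕ-comm (suc n) M) ⟩
      coeff (P (M +ℕ suc n)) n  ≈⟨ partialProd-stable-+ M (suc n) (<-trans (n<1+n n) (n<2^n (suc n))) ⟩
      p x y z n                 ∎

    p-prev : ℕ → Carrier
    p-prev zero    = 0#
    p-prev (suc m) = p x y z m

    coeff-0∷-partialProd : ∀ M {m} → m < 2 ^ M → coeff (0# ∷ P M) m ≈ p-prev m
    coeff-0∷-partialProd M {zero}  _     = refl
    coeff-0∷-partialProd M {suc k} k<2^M = coeff-partialProd M (<-trans (n<1+n k) k<2^M)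

    p-zero : p x y z 0 ≈ 1#
    p-zero = partialProd-stable 0 (s≤s z≤n)

    p-even : ∀ m → p x y z (2 *ℕ m) ≈ p x y z m + (x * y + z) * p-prev m
    p-even m = begin
      p x y z (2 *ℕ m)            ≈⟨ coeff-partialProd (suc m) (*-monoʳ-< 2 (n<2^n m)) ⟨
      coeff (P (suc m)) (2 *ℕ m)  ≈⟨ coeff-partialProd-even m m ⟩
      coeff (P m) m + (x * y + z) * coeff (0# ∷ P m) m
        ≈⟨ +-cong (coeff-partialProd m (n<2^n m)) (*-congˡ (coeff-0∷-partialProd m (n<2^n m))) ⟩
      p x y z m + (x * y + z) * p-prev m ∎

    p-odd : ∀ m → p x y z (suc (2 *ℕ m)) ≈ (x + y) * p x y z m + (x * z) * p-prev m
    p-odd m = begin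
      p x y z (suc (2 *ℕ m))            ≈⟨ coeff-partialProd (suc m) (1+2m<2n (n<2^n m)) ⟨
      coeff (P (suc m)) (suc (2 *ℕ m))  ≈⟨ coeff-partialProd-odd m m ⟩
      (x + y) * coeff (P m) m + (x * z) * coeff (0# ∷ P m) m
        ≈⟨ +-cong (*-congˡ (coeff-partialProd m (n<2^n m)))
                  (*-congˡ (coeff-0∷-partialProd m (n<2^n m))) ⟩
      (x + y) * p x y z m + (x * z) * p-prev m ∎

    -- Q-prev k is Q (k - 1), with Q (-1) = 0.
    Q-prev : ℕ → Carrier
    Q-prev k = p-prev (2 ^ k ∸ 1)

    Q-prev-suc : ∀ k → Q-prev (suc k) ≡ Q x y z k
    Q-prev-suc k = ≡.trans (≡.cong (λ i → p-prev (i ∸ 1)) (2^[1+k]≡2+2*[2^k∸1] k))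
                           (≡.sym (≡.cong (λ i → p x y z (i ∸ 2)) (2^[1+k]≡2+2*[2^k∸1] k)))

    Q-step : ∀ k → Q x y z k ≈ R′ x y z k + (x * y + z) * Q-prev k
    Q-step k = trans (reflexive (≡.cong (λ i → p x y z (i ∸ 2)) (2^[1+k]≡2+2*[2^k∸1] k)))
                     (p-even (2 ^ k ∸ 1))

    R′-step : ∀ k → R′ x y z (suc k) ≈ (x + y) * R′ x y z k + (x * z) * Q-prev k
    R′-step k = trans (reflexive (≡.cong (λ i → p x y z (i ∸ 1)) (2^[1+k]≡2+2*[2^k∸1] k)))
                      (p-odd (2 ^ k ∸ 1))

    Q-prev-step : ∀ k → Q-prev (suc k) ≈ 1# * R′ x y z k + (x * y + z) * Q-prev k
    Q-prev-step k =
      trans (reflexive (Q-prev-suc k)) (trans (Q-step k) (+-congʳ (sym (*-identityˡ _))))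

    R′-one : R′ x y z 1 ≈ x + y
    R′-one = begin
      R′ x y z 1                          ≈⟨ R′-step 0 ⟩
      (x + y) * p x y z 0 + (x * z) * 0#  ≈⟨ +-cong (*-congˡ p-zero) (zeroʳ _) ⟩
      (x + y) * 1# + 0#                   ≈⟨ +-identityʳ _ ⟩
      (x + y) * 1#                        ≈⟨ *-identityʳ _ ⟩
      x + y                               ∎

    Q-one : Q x y z 1 ≈ x * y + x + y + z
    Q-one = begin
      Q x y z 1                             ≈⟨ Q-step 1 ⟩
      R′ x y z 1 + (x * y + z) * Q x y z 0  ≈⟨ +-cong R′-one (*-congˡ p-zero) ⟩
      (x + y) + (x * y + z) * 1#            ≈⟨ solve 3 (λ x y z → (x :+ y) :+ (x :* y :+ z) :* con 1
                                                            := x :* y :+ x :+ y :+ z) refl x y z ⟩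
      x * y + x + y + z                     ∎

    T D : Carrier
    T = x * y + x + y + z
    D = x * x * y + x * y * y + y * z

    transfer-trace : T ≈ (x + y) + (x * y + z)
    transfer-trace = solve 3 (λ x y z → x :* y :+ x :+ y :+ z := (x :+ y) :+ (x :* y :+ z)) refl x y z

    transfer-det : D + (x * z) * 1# ≈ (x + y) * (x * y + z)
    transfer-det = solve 3 (λ x y z → (x :* x :* y :+ x :* y :* y :+ y :* z) :+ (x :* z) :* con 1
                                   := (x :+ y) :* (x :* y :+ z)) refl x y z

proposition3p1 : ∀ {c ℓ : Level} (Rng : CommutativeRing c ℓ) →
    let open CommutativeRing Rng in
    let open Poly Rng in
    ∀ (x y z : Carrier) →
      (Q x y z 0 ≈ 1#) × (Q x y z 1 ≈ x * y + x + y + z) ×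
      (R′ x y z 0 ≈ 1#) × (R′ x y z 1 ≈ x + y) ×
      (∀ (n : ℕ) → 1 ≤ n → Q x y z (suc n) ≈ (x * y + x + y + z) * Q x y z n - (x * x * y + x * y * y + y * z) * Q x y z (n ∸ 1)) ×
      (∀ (n : ℕ) → 1 ≤ n → R′ x y z (suc n) ≈ (x * y + x + y + z) * R′ x y z n - (x * x * y + x * y * y + y * z) * R′ x y z (n ∸ 1))
proposition3p1 Rng x y z =
  p-zero , Q-one , p-zero , R′-one ,
  (λ { (suc k) _ → Q-recurrence k }) , (λ { (suc k) _ → R′-recurrence k })
  where
  open CommutativeRing Rng
  open Poly Rng
  open PowerSeries.ProductCoefficients Rng x y z
  open Transfer Rng
  open SetoidReasoning setoid

  R′-recurrence : ∀ k → R′ x y z (2 +ℕ k) ≈ T * R′ x y z (suc k) - D * R′ x y z k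
  R′-recurrence =
    first-coordinate-recurrence (R′ x y z) Q-prev R′-step Q-prev-step transfer-trace transfer-det

  Q-recurrence : ∀ k → Q x y z (2 +ℕ k) ≈ T * Q x y z (suc k) - D * Q x y z k
  Q-recurrence k = begin
    Q x y z (2 +ℕ k)
      ≡⟨ Q-prev-suc (2 +ℕ k) ⟨
    Q-prev (3 +ℕ k)
      ≈⟨ second-coordinate-recurrence (R′ x y z) Q-prev R′-step Q-prev-step
                                      transfer-trace transfer-det (suc k) ⟩
    T * Q-prev (2 +ℕ k) - D * Q-prev (1 +ℕ k)
      ≡⟨ ≡.cong₂ (λ u v → T * u - D * v) (Q-prev-suc (suc k)) (Q-prev-suc k) ⟩
    T * Q x y z (suc k) - D * Q x y z k ∎
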